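{- Let $V$ be an $r$-dimensional vector space over $\mathbb{F}_{q^n}$, let $U$ be an $\mathbb{F}_q$-subspace of $V$ with $\langle U\rangle_{\mathbb{F}_{q^n}}\neq V$, let $v\in V$ be such that $\langle v\rangle_{\mathbb{F}_{q^n}}\cap\langle U\rangle_{\mathbb{F}_{q^n}}=\{0\}$, and let $U_1=U\oplus\langle v\rangle_{\mathbb{F}_q}$. Let $\Omega=\mathrm{PG}(W,\mathbb{F}_{q^n})$ be a projective subspace of $\mathrm{PG}(V,\mathbb{F}_{q^n})$. If $w_{L_U}(\Omega)=j>0$ and $|\Omega\cap(L_{U_1}\setminus L_U)|>0$, then $|L_{U_1}\cap\Omega|=|L_U\cap\Omega|+q^j$.
   Context: For an $\mathbb{F}_q$-subspace $U$ of $V$, the $\mathbb{F}_q$-linear set $L_U$ is the set of points $\{\langle u\rangle_{\mathbb{F}_{q^n}}: u\in U\setminus\{0\}\}$ of $\mathrm{PG}(V,\mathbb{F}_{q^n})=\mathrm{PG}(r-1,q^n)$. For a projective subspace $\Omega=\mathrm{PG}(W,\mathbb{F}_{q^n})$, its weight in $L_U$ is $w_{L_U}(\Omega)=\dim_{\mathbb{F}_q}(U\cap W)$. $\langle U\rangle_{\mathbb{F}_{q^n}}$ denotes the $\mathbb{F}_{q^n}$-span of $U$. -}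

module Defs where

open import Data.Nat using (ℕ; zero; suc)
open import Data.Fin using (Fin; zero; suc)
open import Data.Vec using (Vec; zipWith; map; replicate)
open import Data.List using (List; length)
open import Data.List.Membership.Propositional using (_∈_)
open import Data.List.Relation.Unary.Unique.Propositional using (Unique)
open import Data.Product using (Σ; _×_)
open import Function using (_∘_)
open import Relation.Binary.PropositionalEquality using (_≡_)
open import Relation.Nullary using (¬_)
open import Algebra.Structures using (IsCommutativeRing)

record Field : Set₁ where
  field
    Carrier : Set
    _+_ _*_ : Carrier → Carrier → Carrier
    -_ : Carrier → Carrier
    0# 1# : Carrier
    isCommutativeRing : IsCommutativeRing _≡_ _+_ _*_ -_ 0# 1#
    0≢1 : ¬ 0# ≡ 1#
    inverse : ∀ x → ¬ x ≡ 0# → Σ Carrier (λ y → x * y ≡ 1#)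

HasSize : {A : Set} → (A → Set) → ℕ → Set
HasSize {A} P m =
  Σ (List A) (λ xs → Unique xs × length xs ≡ m ×
     ((∀ x → P x → x ∈ xs) × (∀ x → x ∈ xs → P x)))

module Geom (F : Field) (r : ℕ) where
  open Field F

  IsSubfield : (Carrier → Set) → Set
  IsSubfield K = K 0# × K 1# × (∀ a b → K a → K b → K (a + b))
    × (∀ a b → K a → K b → K (a * b)) × (∀ a → K a → K (- a))
    × (∀ a (nz : ¬ a ≡ 0#) → K a → K (Σ.proj₁ (inverse a nz)))

  V : Set
  V = Vec Carrier r

  _⊕_ : V → V → V
  _⊕_ = zipWith _+_

  _·_ : Carrier → V → V
  c · x = map (c *_) x

  0V : V
  0V = replicate r 0#

  lincomb : ∀ {m} → (Fin m → Carrier) → (Fin m → V) → V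
  lincomb {zero} cs us = 0V
  lincomb {suc m} cs us = (cs zero · us zero) ⊕ lincomb (cs ∘ suc) (us ∘ suc)

  IsSubspaceOver : (Carrier → Set) → (V → Set) → Set
  IsSubspaceOver K S = S 0V × (∀ x y → S x → S y → S (x ⊕ y))
    × (∀ a x → K a → S x → S (a · x))

  IsFSubspace : (V → Set) → Set
  IsFSubspace S = S 0V × (∀ x y → S x → S y → S (x ⊕ y))
    × (∀ a x → S x → S (a · x))

  SpanF : (V → Set) → V → Set
  SpanF U x = Σ ℕ (λ m → Σ (Fin m → V) (λ us → Σ (Fin m → Carrier) (λ cs →
    (∀ i → U (us i)) × x ≡ lincomb cs us)))

  DimOver : (Carrier → Set) → (V → Set) → ℕ → Set
  DimOver K S j = Σ (Fin j → V) (λ b → (∀ i → S (b i))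
    × (∀ cs → (∀ i → K (cs i)) → lincomb cs b ≡ 0V → ∀ i → cs i ≡ 0#)
    × (∀ x → S x → Σ (Fin j → Carrier) (λ cs → (∀ i → K (cs i)) × x ≡ lincomb cs b)))

  -- ⟨x⟩_F is a point of the linear set L_U (i.e. ⟨x⟩_F = ⟨u⟩_F, u ∈ U∖{0})
  InL : (V → Set) → V → Set
  InL U x = ¬ x ≡ 0V × Σ Carrier (λ c → ¬ c ≡ 0# × U (c · x))

  SamePoint : V → V → Set
  SamePoint x y = Σ Carrier (λ c → ¬ c ≡ 0# × y ≡ c · x)

  -- The set of projective points {⟨x⟩_F : x ≠ 0, P x} (P invariant under
  -- nonzero scalars) has exactly m elements: m pairwise distinct points.
  PointCount : (V → Set) → ℕ → Set
  PointCount P m = Σ (Fin m → V) (λ reps →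
      (∀ i → ¬ reps i ≡ 0V × P (reps i))
    × (∀ i k → SamePoint (reps i) (reps k) → i ≡ k)
    × (∀ x → ¬ x ≡ 0V → P x → Σ (Fin m) (λ i → SamePoint (reps i) x)))

  AddVec : (Carrier → Set) → (V → Set) → V → V → Set
  AddVec K U v x = Σ V (λ u → Σ Carrier (λ a → U u × K a × x ≡ u ⊕ (a · v)))

-- Let ⟨x₀⟩ ∈ Ω be a point of L_{U₁} outside L_U, say c x₀ = u₀ + a v. Then a ≠ 0, so
-- u′ + v ∈ W for u′ = a⁻¹ u₀ ∈ U. A point of L_{U₁} ∩ Ω outside L_U is spanned by some
-- u + v ∈ W with u ∈ U, i.e. with u − u′ ∈ U ∩ W, so the candidates are the q^j vectors
-- s + u′ + v with s ∈ U ∩ W. Because ⟨v⟩ meets ⟨U⟩_F trivially, the coefficient of v in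
-- a vector of ⟨U⟩_F + F v is well defined; hence these vectors are nonzero, span pairwise
-- distinct points, and none of those points lies in L_U. They are therefore exactly
-- q^j new points, added to those of L_U ∩ Ω, which are the finitely many points spanned
-- by U ∩ W.

module Submission where

open import Defs
open import Data.Nat using (ℕ; _+_; _^_; _>_)
open import Data.Product using (Σ; _×_)
open import Data.Unit using (⊤)
open import Relation.Binary.PropositionalEquality using (_≡_)
open import Relation.Nullary using (¬_)

open import Data.Nat using (zero; suc)
open import Algebra.Bundles using (CommutativeRing)
import Algebra.Properties.Ring as RingProperties
import Algebra.Properties.Group as GroupProperties
import Algebra.Properties.CommutativeSemigroup as CommutativeSemigroupProperties
open import Algebra.Structures using (IsCommutativeRing)
open import Data.Empty using (⊥-elim)
open import Data.Fin as Fin using (Fin; zero; suc; splitAt; join; finToFun; funToFin; combine)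
open import Data.Fin.Properties using (splitAt-join; join-splitAt; any?; finToFun-funToFin; funToFin-finToFin)
open import Data.Sum using (_⊎_; inj₁; inj₂; [_,_])
open import Data.List using (List; lookup)
open import Data.List.Membership.Propositional.Properties using (∈-lookup)
import Data.List.Relation.Unary.All as All
open import Data.List.Relation.Unary.AllPairs using (_∷_)
open import Data.List.Relation.Unary.Any using (index)
open import Data.List.Relation.Unary.Any.Properties using (lookup-index)
open import Data.List.Relation.Unary.Unique.Propositional using (Unique)
open import Data.Product using (_,_; proj₁; proj₂)
open import Data.Vec using (Vec; []; _∷_; zipWith; map; replicate)
open import Data.Vec.Properties
  using ( ≡-dec; zipWith-assoc; zipWith-comm; zipWith-identityˡ; zipWith-identityʳ
        ; map-∘; map-cong; map-id; map-replicate)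
open import Function using (_∘_)
open import Relation.Binary.Definitions using (DecidableEquality)
open import Relation.Binary.PropositionalEquality
  using (refl; sym; trans; cong; cong₂; subst; module ≡-Reasoning)
open import Relation.Nullary using (Dec; yes; no)
open import Relation.Nullary.Decidable using (map′; ¬?; _×-dec_)

record Enumeration {A : Set} (P : A → Set) (m : ℕ) : Set where
  field
    at           : Fin m → A
    at-∈         : ∀ i → P (at i)
    at-injective : ∀ i k → at i ≡ at k → i ≡ k
    indexOf      : ∀ x → P x → Fin m
    at-indexOf   : ∀ x (px : P x) → at (indexOf x px) ≡ x

lookup-injective : {A : Set} {xs : List A} → Unique xs →
                   ∀ i k → lookup xs i ≡ lookup xs k → i ≡ k
lookup-injective (_ ∷ _) zero zero _ = refl
lookup-injective (x∉ ∷ _) zero (suc k) eq = ⊥-elim (All.lookup x∉ (∈-lookup k) eq)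
lookup-injective (x∉ ∷ _) (suc i) zero eq = ⊥-elim (All.lookup x∉ (∈-lookup i) (sym eq))
lookup-injective (_ ∷ u) (suc i) (suc k) eq = cong suc (lookup-injective u i k eq)

funToFin-cong : ∀ {m n} {f g : Fin m → Fin n} → (∀ i → f i ≡ g i) → funToFin f ≡ funToFin g
funToFin-cong {zero} eq = refl
funToFin-cong {suc m} eq = cong₂ combine (eq zero) (funToFin-cong (eq ∘ suc))

hasSize⇒enumeration : {A : Set} {P : A → Set} {m : ℕ} → HasSize P m → Enumeration P m
hasSize⇒enumeration (xs , unique , refl , complete , sound) = record
  { at           = lookup xs
  ; at-∈         = λ i → sound _ (∈-lookup i)
  ; at-injective = lookup-injective unique
  ; indexOf      = λ x px → index (complete x px)
  ; at-indexOf   = λ x px → sym (lookup-index (complete x px))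
  }

enumeration⇒≟ : {A : Set} {m : ℕ} → Enumeration {A} (λ _ → ⊤) m → DecidableEquality A
enumeration⇒≟ E x y = map′ same-index (cong (λ z → indexOf z _)) (indexOf x _ Fin.≟ indexOf y _)
  where
  open Enumeration E
  same-index : indexOf x _ ≡ indexOf y _ → x ≡ y
  same-index eq = trans (sym (at-indexOf x _)) (trans (cong at eq) (at-indexOf y _))

module FieldArithmetic (F : Field) where
  open Field F renaming (_+_ to infixl 6 _+ᶠ_; _*_ to infixl 7 _*ᶠ_; -_ to infix 8 -_)
  open IsCommutativeRing isCommutativeRing using (*-assoc; *-comm; *-identityˡ; zeroˡ; zeroʳ)
  open ≡-Reasoning

  ring : CommutativeRing _ _
  ring = record { isCommutativeRing = isCommutativeRing }

  open RingProperties (CommutativeRing.ring ring) using (-1*x≈-x)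
  open GroupProperties (CommutativeRing.+-group ring) using (x∙y⁻¹≈ε⇒x≈y)
  open CommutativeSemigroupProperties (CommutativeRing.+-commutativeSemigroup ring)
    renaming (interchange to +-interchange) using () public

  infix 9 _⁻¹⟨_⟩
  _⁻¹⟨_⟩ : (a : Carrier) → ¬ a ≡ 0# → Carrier
  a ⁻¹⟨ a≢0 ⟩ = proj₁ (inverse a a≢0)

  ⁻¹-inverseˡ : ∀ a (a≢0 : ¬ a ≡ 0#) → a ⁻¹⟨ a≢0 ⟩ *ᶠ a ≡ 1#
  ⁻¹-inverseˡ a a≢0 = trans (*-comm _ a) (proj₂ (inverse a a≢0))

  1≢0 : ¬ 1# ≡ 0#
  1≢0 = 0≢1 ∘ sym

  ⁻¹-nonZero : ∀ a (a≢0 : ¬ a ≡ 0#) → ¬ a ⁻¹⟨ a≢0 ⟩ ≡ 0#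
  ⁻¹-nonZero a a≢0 a⁻¹≡0 = 1≢0 (begin
    1#                ≡⟨ ⁻¹-inverseˡ a a≢0 ⟨
    a ⁻¹⟨ a≢0 ⟩ *ᶠ a  ≡⟨ cong (_*ᶠ a) a⁻¹≡0 ⟩
    0# *ᶠ a           ≡⟨ zeroˡ a ⟩
    0#                ∎)

  *-nonZero : ∀ a b → ¬ a ≡ 0# → ¬ b ≡ 0# → ¬ a *ᶠ b ≡ 0#
  *-nonZero a b a≢0 b≢0 ab≡0 = b≢0 (begin
    b                        ≡⟨ *-identityˡ b ⟨
    1# *ᶠ b                  ≡⟨ cong (_*ᶠ b) (⁻¹-inverseˡ a a≢0) ⟨
    a ⁻¹⟨ a≢0 ⟩ *ᶠ a *ᶠ b    ≡⟨ *-assoc _ a b ⟩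
    a ⁻¹⟨ a≢0 ⟩ *ᶠ (a *ᶠ b)  ≡⟨ cong (a ⁻¹⟨ a≢0 ⟩ *ᶠ_) ab≡0 ⟩
    a ⁻¹⟨ a≢0 ⟩ *ᶠ 0#        ≡⟨ zeroʳ _ ⟩
    0#                       ∎)

  x-y≡0⇒x≡y : ∀ x y → x +ᶠ - 1# *ᶠ y ≡ 0# → x ≡ y
  x-y≡0⇒x≡y x y eq = x∙y⁻¹≈ε⇒x≈y x y (trans (cong (x +ᶠ_) (sym (-1*x≈-x y))) eq)

module VectorAlgebra (F : Field) where
  open Field F renaming (_+_ to infixl 6 _+ᶠ_; _*_ to infixl 7 _*ᶠ_; -_ to infix 8 -_)
  open IsCommutativeRing isCommutativeRing
    using ( +-assoc; +-comm; +-identityˡ; +-identityʳ; -‿inverseʳ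
          ; *-assoc; *-identityˡ; distribˡ; distribʳ; zeroˡ; zeroʳ)
  open FieldArithmetic F
  open ≡-Reasoning

  private variable k : ℕ

  infixl 6 _⊕_ _⊖_
  infixr 7 _·_

  _⊕_ : Vec Carrier k → Vec Carrier k → Vec Carrier k
  _⊕_ = zipWith _+ᶠ_

  _·_ : Carrier → Vec Carrier k → Vec Carrier k
  c · x = map (c *ᶠ_) x

  0ᵥ : Vec Carrier k
  0ᵥ = replicate _ 0#

  _⊖_ : Vec Carrier k → Vec Carrier k → Vec Carrier k
  x ⊖ y = x ⊕ - 1# · y

  ⊕-assoc : (x y z : Vec Carrier k) → (x ⊕ y) ⊕ z ≡ x ⊕ (y ⊕ z)
  ⊕-assoc = zipWith-assoc +-assoc

  ⊕-comm : (x y : Vec Carrier k) → x ⊕ y ≡ y ⊕ x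
  ⊕-comm = zipWith-comm +-comm

  ⊕-identityˡ : (x : Vec Carrier k) → 0ᵥ ⊕ x ≡ x
  ⊕-identityˡ = zipWith-identityˡ +-identityˡ

  ⊕-identityʳ : (x : Vec Carrier k) → x ⊕ 0ᵥ ≡ x
  ⊕-identityʳ = zipWith-identityʳ +-identityʳ

  ·-assoc : ∀ a b (x : Vec Carrier k) → a · b · x ≡ (a *ᶠ b) · x
  ·-assoc a b x = trans (sym (map-∘ (a *ᶠ_) (b *ᶠ_) x)) (map-cong (λ c → sym (*-assoc a b c)) x)

  ·-identityˡ : (x : Vec Carrier k) → 1# · x ≡ x
  ·-identityˡ x = trans (map-cong *-identityˡ x) (map-id x)

  ·-zeroʳ : ∀ a → a · 0ᵥ {k} ≡ 0ᵥ
  ·-zeroʳ {k} a = trans (map-replicate (a *ᶠ_) 0# k) (cong (replicate k) (zeroʳ a))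

  ·-zeroˡ : (x : Vec Carrier k) → 0# · x ≡ 0ᵥ
  ·-zeroˡ [] = refl
  ·-zeroˡ (c ∷ x) = cong₂ _∷_ (zeroˡ c) (·-zeroˡ x)

  ·-distribˡ : ∀ a (x y : Vec Carrier k) → a · (x ⊕ y) ≡ a · x ⊕ a · y
  ·-distribˡ a [] [] = refl
  ·-distribˡ a (b ∷ x) (c ∷ y) = cong₂ _∷_ (distribˡ a b c) (·-distribˡ a x y)

  ·-distribʳ : ∀ a b (x : Vec Carrier k) → (a +ᶠ b) · x ≡ a · x ⊕ b · x
  ·-distribʳ a b [] = refl
  ·-distribʳ a b (c ∷ x) = cong₂ _∷_ (distribʳ c a b) (·-distribʳ a b x)

  ⊖-self : (x : Vec Carrier k) → x ⊖ x ≡ 0ᵥ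
  ⊖-self x = begin
    x ⊕ - 1# · x          ≡⟨ cong (_⊕ - 1# · x) (·-identityˡ x) ⟨
    1# · x ⊕ - 1# · x     ≡⟨ ·-distribʳ 1# (- 1#) x ⟨
    (1# +ᶠ - 1#) · x      ≡⟨ cong (_· x) (-‿inverseʳ 1#) ⟩
    0# · x                ≡⟨ ·-zeroˡ x ⟩
    0ᵥ                    ∎

  ⊖-⊕-cancel : (x y : Vec Carrier k) → x ⊖ y ⊕ y ≡ x
  ⊖-⊕-cancel x y = begin
    x ⊕ - 1# · y ⊕ y      ≡⟨ ⊕-assoc x _ y ⟩
    x ⊕ (- 1# · y ⊕ y)    ≡⟨ cong (x ⊕_) (⊕-comm _ y) ⟩
    x ⊕ (y ⊖ y)           ≡⟨ cong (x ⊕_) (⊖-self y) ⟩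
    x ⊕ 0ᵥ                ≡⟨ ⊕-identityʳ x ⟩
    x                     ∎

  ⊕-⊖-cancel : (x y : Vec Carrier k) → x ⊕ y ⊖ y ≡ x
  ⊕-⊖-cancel x y = begin
    x ⊕ y ⊕ - 1# · y      ≡⟨ ⊕-assoc x y _ ⟩
    x ⊕ (y ⊖ y)           ≡⟨ cong (x ⊕_) (⊖-self y) ⟩
    x ⊕ 0ᵥ                ≡⟨ ⊕-identityʳ x ⟩
    x                     ∎

  ⊕-cancelʳ : (x y z : Vec Carrier k) → x ⊕ z ≡ y ⊕ z → x ≡ y
  ⊕-cancelʳ x y z eq = begin
    x              ≡⟨ ⊕-⊖-cancel x z ⟨
    x ⊕ z ⊖ z      ≡⟨ cong (_⊖ z) eq ⟩
    y ⊕ z ⊖ z      ≡⟨ ⊕-⊖-cancel y z ⟩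
    y              ∎

  ⊕-interchange : (p q p′ q′ : Vec Carrier k) → (p ⊕ q) ⊕ (p′ ⊕ q′) ≡ (p ⊕ p′) ⊕ (q ⊕ q′)
  ⊕-interchange [] [] [] [] = refl
  ⊕-interchange (a ∷ p) (b ∷ q) (c ∷ p′) (d ∷ q′) =
    cong₂ _∷_ (+-interchange a b c d) (⊕-interchange p q p′ q′)

  ⊕-⊖-interchange : (p q p′ q′ : Vec Carrier k) → (p ⊕ q) ⊖ (p′ ⊕ q′) ≡ (p ⊖ p′) ⊕ (q ⊖ q′)
  ⊕-⊖-interchange p q p′ q′ =
    trans (cong ((p ⊕ q) ⊕_) (·-distribˡ (- 1#) p′ q′)) (⊕-interchange p q _ _)

  ·-⊖-distribʳ : ∀ a b (x : Vec Carrier k) → a · x ⊖ b · x ≡ (a +ᶠ - 1# *ᶠ b) · x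
  ·-⊖-distribʳ a b x = trans (cong (a · x ⊕_) (·-assoc (- 1#) b x)) (sym (·-distribʳ a _ x))

  ·-unscale : ∀ a (a≢0 : ¬ a ≡ 0#) {x y : Vec Carrier k} → y ≡ a · x → x ≡ a ⁻¹⟨ a≢0 ⟩ · y
  ·-unscale a a≢0 {x} {y} y≡ax = sym (begin
    a ⁻¹⟨ a≢0 ⟩ · y           ≡⟨ cong (a ⁻¹⟨ a≢0 ⟩ ·_) y≡ax ⟩
    a ⁻¹⟨ a≢0 ⟩ · a · x       ≡⟨ ·-assoc _ a x ⟩
    (a ⁻¹⟨ a≢0 ⟩ *ᶠ a) · x    ≡⟨ cong (_· x) (⁻¹-inverseˡ a a≢0) ⟩
    1# · x                    ≡⟨ ·-identityˡ x ⟩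
    x                         ∎)

  ·-nonZero : ∀ a {x : Vec Carrier k} → ¬ a ≡ 0# → ¬ x ≡ 0ᵥ → ¬ a · x ≡ 0ᵥ
  ·-nonZero a a≢0 x≢0 ax≡0 = x≢0 (trans (·-unscale a a≢0 (sym ax≡0)) (·-zeroʳ _))

  ⊕-·-unscale : ∀ a (a≢0 : ¬ a ≡ 0#) {y u w : Vec Carrier k} → y ≡ u ⊕ a · w →
                a ⁻¹⟨ a≢0 ⟩ · y ≡ a ⁻¹⟨ a≢0 ⟩ · u ⊕ w
  ⊕-·-unscale a a≢0 {y} {u} {w} y≡u+aw = begin
    a ⁻¹⟨ a≢0 ⟩ · y                             ≡⟨ cong (a ⁻¹⟨ a≢0 ⟩ ·_) y≡u+aw ⟩
    a ⁻¹⟨ a≢0 ⟩ · (u ⊕ a · w)                   ≡⟨ ·-distribˡ _ u _ ⟩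
    a ⁻¹⟨ a≢0 ⟩ · u ⊕ a ⁻¹⟨ a≢0 ⟩ · a · w       ≡⟨ cong (a ⁻¹⟨ a≢0 ⟩ · u ⊕_) (·-unscale a a≢0 refl) ⟨
    a ⁻¹⟨ a≢0 ⟩ · u ⊕ w                         ∎

  x⊕y≡z⊕w⇒y⊖w≡z⊖x : {x y z w : Vec Carrier k} → x ⊕ y ≡ z ⊕ w → y ⊖ w ≡ z ⊖ x
  x⊕y≡z⊕w⇒y⊖w≡z⊖x {x = x} {y} {z} {w} eq = begin
    y ⊖ w                     ≡⟨ ⊕-identityˡ (y ⊖ w) ⟨
    0ᵥ ⊕ (y ⊖ w)              ≡⟨ cong (_⊕ (y ⊖ w)) (⊖-self x) ⟨
    (x ⊖ x) ⊕ (y ⊖ w)         ≡⟨ ⊕-⊖-interchange x y x w ⟨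
    (x ⊕ y) ⊖ (x ⊕ w)         ≡⟨ cong (_⊖ (x ⊕ w)) eq ⟩
    (z ⊕ w) ⊖ (x ⊕ w)         ≡⟨ ⊕-⊖-interchange z w x w ⟩
    (z ⊖ x) ⊕ (w ⊖ w)         ≡⟨ cong ((z ⊖ x) ⊕_) (⊖-self w) ⟩
    (z ⊖ x) ⊕ 0ᵥ              ≡⟨ ⊕-identityʳ (z ⊖ x) ⟩
    z ⊖ x                     ∎

module Points (F : Field) (r : ℕ) where
  open Field F renaming (_+_ to infixl 6 _+ᶠ_; _*_ to infixl 7 _*ᶠ_; -_ to infix 8 -_)
  open FieldArithmetic F
  open VectorAlgebra F
  open Geom F r using (V; 0V; SamePoint; PointCount)
  open ≡-Reasoning

  samePoint-refl : ∀ x → SamePoint x x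
  samePoint-refl x = 1# , 1≢0 , sym (·-identityˡ x)

  samePoint-sym : ∀ {x y} → SamePoint x y → SamePoint y x
  samePoint-sym (c , c≢0 , y≡cx) = c ⁻¹⟨ c≢0 ⟩ , ⁻¹-nonZero c c≢0 , ·-unscale c c≢0 y≡cx

  samePoint-trans : ∀ {x y z} → SamePoint x y → SamePoint y z → SamePoint x z
  samePoint-trans {x} (c , c≢0 , y≡cx) (d , d≢0 , z≡dy) =
    d *ᶠ c , *-nonZero d c d≢0 c≢0 , trans z≡dy (trans (cong (d ·_) y≡cx) (·-assoc d c x))

  samePoint-nonZero : ∀ {x y} → ¬ x ≡ 0V → SamePoint x y → ¬ y ≡ 0V
  samePoint-nonZero x≢0 (c , c≢0 , y≡cx) y≡0 = ·-nonZero c c≢0 x≢0 (trans (sym y≡cx) y≡0)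

  pointCount-cong : {P Q : V → Set} {m : ℕ} →
                    (∀ x → ¬ x ≡ 0V → P x → Q x) → (∀ x → ¬ x ≡ 0V → Q x → P x) →
                    PointCount P m → PointCount Q m
  pointCount-cong P⇒Q Q⇒P (reps , reps-ok , reps-distinct , reps-cover) =
    reps , (λ i → proj₁ (reps-ok i) , P⇒Q _ (proj₁ (reps-ok i)) (proj₂ (reps-ok i))) ,
    reps-distinct , (λ x x≢0 Qx → reps-cover x x≢0 (Q⇒P x x≢0 Qx))

  pointCount-++ : {P : V → Set} {m n : ℕ} → PointCount P m →
                  (t : Fin n → V) → (∀ i → ¬ t i ≡ 0V) →
                  (∀ i k → SamePoint (t i) (t k) → i ≡ k) →
                  (∀ x i → P x → ¬ SamePoint x (t i)) →
                  PointCount (λ x → P x ⊎ Σ (Fin n) (λ i → SamePoint (t i) x)) (m + n)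
  pointCount-++ {P} {m} {n} (reps , reps-ok , reps-distinct , reps-cover) t t≢0 t-distinct P∌t =
    reps′ ∘ splitAt m , ok ∘ splitAt m , distinct , cover
    where
    reps′ : Fin m ⊎ Fin n → V
    reps′ = [ reps , t ]

    ok : ∀ s → ¬ reps′ s ≡ 0V × (P (reps′ s) ⊎ Σ (Fin n) (λ i → SamePoint (t i) (reps′ s)))
    ok (inj₁ i) = proj₁ (reps-ok i) , inj₁ (proj₂ (reps-ok i))
    ok (inj₂ i) = t≢0 i , inj₂ (i , samePoint-refl (t i))

    distinct′ : ∀ s s′ → SamePoint (reps′ s) (reps′ s′) → s ≡ s′
    distinct′ (inj₁ i) (inj₁ k) sp = cong inj₁ (reps-distinct i k sp)
    distinct′ (inj₁ i) (inj₂ k) sp = ⊥-elim (P∌t _ k (proj₂ (reps-ok i)) sp)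
    distinct′ (inj₂ i) (inj₁ k) sp = ⊥-elim (P∌t _ i (proj₂ (reps-ok k)) (samePoint-sym sp))
    distinct′ (inj₂ i) (inj₂ k) sp = cong inj₂ (t-distinct i k sp)

    distinct : ∀ p p′ → SamePoint (reps′ (splitAt m p)) (reps′ (splitAt m p′)) → p ≡ p′
    distinct p p′ sp = begin
      p                         ≡⟨ join-splitAt m n p ⟨
      join m n (splitAt m p)    ≡⟨ cong (join m n) (distinct′ (splitAt m p) (splitAt m p′) sp) ⟩
      join m n (splitAt m p′)   ≡⟨ join-splitAt m n p′ ⟩
      p′                        ∎

    cover′ : ∀ x → ¬ x ≡ 0V → P x ⊎ Σ (Fin n) (λ i → SamePoint (t i) x) →
             Σ (Fin m ⊎ Fin n) (λ s → SamePoint (reps′ s) x)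
    cover′ x x≢0 (inj₁ Px) with reps-cover x x≢0 Px
    ... | i , sp = inj₁ i , sp
    cover′ x x≢0 (inj₂ (i , sp)) = inj₂ i , sp

    cover : ∀ x → ¬ x ≡ 0V → P x ⊎ Σ (Fin n) (λ i → SamePoint (t i) x) →
            Σ (Fin (m + n)) (λ p → SamePoint (reps′ (splitAt m p)) x)
    cover x x≢0 Px with cover′ x x≢0 Px
    ... | s , sp = join m n s , subst (λ s → SamePoint (reps′ s) x) (sym (splitAt-join m n s)) sp

  Spanned : {k : ℕ} → (Fin k → V) → V → Set
  Spanned {k} s x = Σ (Fin k) (λ i → ¬ s i ≡ 0V × SamePoint (s i) x)

  spanned-resp : ∀ {k} {s : Fin k → V} {x y} → Spanned s x → SamePoint x y → Spanned s y
  spanned-resp (i , sᵢ≢0 , sp) sp′ = i , sᵢ≢0 , samePoint-trans sp sp′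

  spanned-suc : ∀ {k} {s : Fin (suc k) → V} {x} → Spanned (s ∘ suc) x → Spanned s x
  spanned-suc (i , p) = suc i , p

  spanned-uncons : ∀ {k} {s : Fin (suc k) → V} {x} → Spanned s x →
                   (¬ s zero ≡ 0V × SamePoint (s zero) x) ⊎ Spanned (s ∘ suc) x
  spanned-uncons (zero , p) = inj₁ p
  spanned-uncons (suc i , p) = inj₂ (i , p)

  module FiniteField {N : ℕ} (F-enum : Enumeration {Carrier} (λ _ → ⊤) N) where
    open Enumeration F-enum

    _≟_ : DecidableEquality Carrier
    _≟_ = enumeration⇒≟ F-enum

    _≟V_ : DecidableEquality V
    _≟V_ = ≡-dec _≟_

    samePoint? : ∀ x y → Dec (SamePoint x y)
    samePoint? x y = map′ (λ (i , p) → at i , p) via-index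
                          (any? (λ i → ¬? (at i ≟ 0#) ×-dec (y ≟V (at i · x))))
      where
      via-index : SamePoint x y → Σ (Fin N) (λ i → ¬ at i ≡ 0# × y ≡ at i · x)
      via-index (c , p) = indexOf c _ , subst (λ a → ¬ a ≡ 0# × y ≡ a · x) (sym (at-indexOf c _)) p

    pointCount-spanned : ∀ k (s : Fin k → V) → Σ ℕ (PointCount (Spanned s))
    pointCount-spanned zero s = 0 , (λ ()) , (λ ()) , (λ ()) , λ _ _ ()
    pointCount-spanned (suc k) s with pointCount-spanned k (s ∘ suc)
    ... | m , pc@(reps , reps-ok , _ , reps-cover)
        with s zero ≟V 0V | any? (λ i → samePoint? (reps i) (s zero))
    ... | yes s₀≡0 | _ = m , pointCount-cong (λ _ _ → spanned-suc)
            (λ _ _ → [ (λ (s₀≢0 , _) → ⊥-elim (s₀≢0 s₀≡0)) , (λ p → p) ] ∘ spanned-uncons) pc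
    ... | no _ | yes (i , sp) = m , pointCount-cong (λ _ _ → spanned-suc)
            (λ _ _ → [ (λ (_ , sp₀) → spanned-resp (proj₂ (reps-ok i)) (samePoint-trans sp sp₀))
                     , (λ p → p) ] ∘ spanned-uncons) pc
    ... | no s₀≢0 | no s₀-new = m + 1 , pointCount-cong
            (λ _ _ → [ spanned-suc , (λ (_ , sp) → zero , s₀≢0 , sp) ])
            (λ _ _ → [ (λ (_ , sp) → inj₂ (zero , sp)) , inj₁ ] ∘ spanned-uncons)
            (pointCount-++ {n = 1} pc (λ _ → s zero) (λ _ → s₀≢0) (λ { zero zero _ → refl }) s₀∉)
      where
      s₀∉ : ∀ x i → Spanned (s ∘ suc) x → ¬ SamePoint x (s zero)
      s₀∉ x _ spanned@(j , sⱼ≢0 , sp) sp₀ with reps-cover x (samePoint-nonZero sⱼ≢0 sp) spanned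
      ... | l , sp′ = s₀-new (l , samePoint-trans sp′ sp₀)

module Subspaces (F : Field) (r : ℕ) (K : Field.Carrier F → Set) (K-subfield : Geom.IsSubfield F r K) where
  open Field F renaming (_+_ to infixl 6 _+ᶠ_; _*_ to infixl 7 _*ᶠ_; -_ to infix 8 -_)
  open FieldArithmetic F
  open VectorAlgebra F
  open Geom F r using (V; 0V; lincomb; IsSubspaceOver; IsFSubspace; DimOver)
  open ≡-Reasoning

  K-0 : K 0#
  K-0 = proj₁ K-subfield

  K-1 : K 1#
  K-1 = proj₁ (proj₂ K-subfield)

  K-+ : ∀ a b → K a → K b → K (a +ᶠ b)
  K-+ = proj₁ (proj₂ (proj₂ K-subfield))

  K-* : ∀ a b → K a → K b → K (a *ᶠ b)
  K-* = proj₁ (proj₂ (proj₂ (proj₂ K-subfield)))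

  K-neg : ∀ a → K a → K (- a)
  K-neg = proj₁ (proj₂ (proj₂ (proj₂ (proj₂ K-subfield))))

  K-⁻¹ : ∀ a (a≢0 : ¬ a ≡ 0#) → K a → K (a ⁻¹⟨ a≢0 ⟩)
  K-⁻¹ = proj₂ (proj₂ (proj₂ (proj₂ (proj₂ K-subfield))))

  lincomb-cong : ∀ {m} {cs ds : Fin m → Carrier} (us : Fin m → V) →
                 (∀ i → cs i ≡ ds i) → lincomb cs us ≡ lincomb ds us
  lincomb-cong {zero} us eq = refl
  lincomb-cong {suc m} us eq =
    cong₂ _⊕_ (cong (_· us zero) (eq zero)) (lincomb-cong (us ∘ suc) (eq ∘ suc))

  lincomb-⊖ : ∀ {m} (cs ds : Fin m → Carrier) (us : Fin m → V) →
              lincomb cs us ⊖ lincomb ds us ≡ lincomb (λ i → cs i +ᶠ - 1# *ᶠ ds i) us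
  lincomb-⊖ {zero} cs ds us = trans (cong (0ᵥ ⊕_) (·-zeroʳ (- 1#))) (⊕-identityʳ 0ᵥ)
  lincomb-⊖ {suc m} cs ds us =
    trans (⊕-⊖-interchange _ _ _ _)
          (cong₂ _⊕_ (·-⊖-distribʳ (cs zero) (ds zero) (us zero))
                     (lincomb-⊖ (cs ∘ suc) (ds ∘ suc) (us ∘ suc)))

  lincomb-∈ : ∀ {S} → IsSubspaceOver K S → ∀ {m} (cs : Fin m → Carrier) (us : Fin m → V) →
              (∀ i → K (cs i)) → (∀ i → S (us i)) → S (lincomb cs us)
  lincomb-∈ (S-0 , _ , _) {zero} cs us K-cs S-us = S-0
  lincomb-∈ S-sub@(_ , S-⊕ , S-·) {suc m} cs us K-cs S-us =
    S-⊕ _ _ (S-· _ _ (K-cs zero) (S-us zero))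
            (lincomb-∈ S-sub (cs ∘ suc) (us ∘ suc) (K-cs ∘ suc) (S-us ∘ suc))

  subspace-∩ : ∀ {U W} → IsSubspaceOver K U → IsFSubspace W → IsSubspaceOver K (λ x → U x × W x)
  subspace-∩ (U-0 , U-⊕ , U-·) (W-0 , W-⊕ , W-·) =
    (U-0 , W-0) ,
    (λ x y (Ux , Wx) (Uy , Wy) → U-⊕ x y Ux Uy , W-⊕ x y Wx Wy) ,
    (λ a x Ka (Ux , Wx) → U-· a x Ka Ux , W-· a x Wx)

  dimOver⇒enumeration : ∀ {S q j} → IsSubspaceOver K S → HasSize K q → DimOver K S j → Enumeration S (q ^ j)
  dimOver⇒enumeration {S} {q} {j} S-sub |K| (b , S-b , b-independent , b-spans) = record
    { at           = at
    ; at-∈         = λ k → lincomb-∈ S-sub _ b (λ _ → K.at-∈ _) S-b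
    ; at-injective = at-injective
    ; indexOf      = λ x Sx → funToFin (coordinates x Sx)
    ; at-indexOf   = at-indexOf
    }
    where
    module K = Enumeration (hasSize⇒enumeration |K|)

    coefficients : Fin (q ^ j) → Fin j → Carrier
    coefficients k i = K.at (finToFun k i)

    at : Fin (q ^ j) → V
    at k = lincomb (coefficients k) b

    coordinates : ∀ x → S x → Fin j → Fin q
    coordinates x Sx i = K.indexOf (proj₁ (b-spans x Sx) i) (proj₁ (proj₂ (b-spans x Sx)) i)

    at-indexOf : ∀ x (Sx : S x) → at (funToFin (coordinates x Sx)) ≡ x
    at-indexOf x Sx = begin
      lincomb (coefficients (funToFin (coordinates x Sx))) b
        ≡⟨ lincomb-cong b (λ i → trans (cong K.at (finToFun-funToFin (coordinates x Sx) i))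
                                       (K.at-indexOf _ _)) ⟩
      lincomb (proj₁ (b-spans x Sx)) b
        ≡⟨ proj₂ (proj₂ (b-spans x Sx)) ⟨
      x ∎

    at-injective : ∀ k k′ → at k ≡ at k′ → k ≡ k′
    at-injective k k′ eq = begin
      k                              ≡⟨ funToFin-finToFin {j} {q} k ⟨
      funToFin (finToFun {q} {j} k)  ≡⟨ funToFin-cong same-digits ⟩
      funToFin (finToFun {q} {j} k′) ≡⟨ funToFin-finToFin {j} {q} k′ ⟩
      k′                             ∎
      where
      difference≡0 : lincomb (λ i → coefficients k i +ᶠ - 1# *ᶠ coefficients k′ i) b ≡ 0V
      difference≡0 = trans (sym (lincomb-⊖ _ _ b)) (trans (cong (at k ⊖_) (sym eq)) (⊖-self (at k)))
      same-digits : ∀ i → finToFun {q} {j} k i ≡ finToFun k′ i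
      same-digits i = K.at-injective _ _ (x-y≡0⇒x≡y _ _
        (b-independent _ (λ i → K-+ _ _ (K.at-∈ _) (K-* _ _ (K-neg 1# K-1) (K.at-∈ _))) difference≡0 i))

module Extension (F : Field) (r : ℕ) (K : Field.Carrier F → Set) (K-subfield : Geom.IsSubfield F r K)
  {N : ℕ} (F-enum : Enumeration {Field.Carrier F} (λ _ → ⊤) N)
  (U : Geom.V F r → Set) (U-subspace : Geom.IsSubspaceOver F r K U)
  (v : Geom.V F r)
  (⟨v⟩∩⟨U⟩≡0 : ∀ c x → x ≡ Geom._·_ F r c v → Geom.SpanF F r U x → x ≡ Geom.0V F r)
  (W : Geom.V F r → Set) (W-subspace : Geom.IsFSubspace F r W) where

  open Field F renaming (_+_ to infixl 6 _+ᶠ_; _*_ to infixl 7 _*ᶠ_; -_ to infix 8 -_)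
  open FieldArithmetic F
  open VectorAlgebra F
  open Geom F r using (V; 0V; SpanF; SamePoint; PointCount; InL; AddVec)
  open Points F r
  open FiniteField F-enum
  open Subspaces F r K K-subfield
  open ≡-Reasoning

  U₁ : V → Set
  U₁ = AddVec K U v

  L L₁ : V → Set
  L x = InL U x × W x
  L₁ x = InL U₁ x × W x

  U-⊕ : ∀ {x y} → U x → U y → U (x ⊕ y)
  U-⊕ = proj₁ (proj₂ U-subspace) _ _

  U-· : ∀ {a x} → K a → U x → U (a · x)
  U-· = proj₂ (proj₂ U-subspace) _ _

  U-⊖ : ∀ {x y} → U x → U y → U (x ⊖ y)
  U-⊖ Ux Uy = U-⊕ Ux (U-· (K-neg 1# K-1) Uy)

  W-⊕ : ∀ {x y} → W x → W y → W (x ⊕ y)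
  W-⊕ = proj₁ (proj₂ W-subspace) _ _

  W-· : ∀ a {x} → W x → W (a · x)
  W-· a = proj₂ (proj₂ W-subspace) a _

  W-⊖ : ∀ {x y} → W x → W y → W (x ⊖ y)
  W-⊖ Wx Wy = W-⊕ Wx (W-· (- 1#) Wy)

  span₂ : ∀ a b {u₁ u₂ x} → U u₁ → U u₂ → x ≡ a · u₁ ⊕ b · u₂ → SpanF U x
  span₂ a b {u₁} {u₂} U-u₁ U-u₂ eq =
    2 , (λ { zero → u₁ ; (suc _) → u₂ }) , (λ { zero → a ; (suc _) → b }) ,
    (λ { zero → U-u₁ ; (suc _) → U-u₂ }) , trans eq (cong (a · u₁ ⊕_) (sym (⊕-identityʳ _)))

  ⊕-v-vanishes : ∀ {a u} → a · v ≡ 0V → u ⊕ a · v ≡ u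
  ⊕-v-vanishes {u = u} av≡0 = trans (cong (u ⊕_) av≡0) (⊕-identityʳ u)

  U⊆U₁ : ∀ {u} → U u → U₁ u
  U⊆U₁ {u} U-u = u , 0# , U-u , K-0 , sym (⊕-v-vanishes (·-zeroˡ v))

  outside-point⇒translate : ∀ {x₀} → W x₀ → InL U₁ x₀ → ¬ InL U x₀ →
                            ¬ v ≡ 0V × Σ V (λ u′ → U u′ × W (u′ ⊕ v))
  outside-point⇒translate {x₀} W-x₀ (x₀≢0 , c , c≢0 , u , a , U-u , K-a , cx₀≡u+av) x₀∉L =
    v≢0 , a ⁻¹⟨ a≢0 ⟩ · u , U-· (K-⁻¹ a a≢0 K-a) U-u ,
    subst W (⊕-·-unscale a a≢0 cx₀≡u+av) (W-· _ (W-· c W-x₀))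
    where
    av≢0 : ¬ a · v ≡ 0V
    av≢0 av≡0 = x₀∉L (x₀≢0 , c , c≢0 , subst U (sym (trans cx₀≡u+av (⊕-v-vanishes av≡0))) U-u)
    v≢0 : ¬ v ≡ 0V
    v≢0 v≡0 = av≢0 (trans (cong (a ·_) v≡0) (·-zeroʳ a))
    a≢0 : ¬ a ≡ 0#
    a≢0 a≡0 = av≢0 (trans (cong (_· v) a≡0) (·-zeroˡ v))

  module _ (v≢0 : ¬ v ≡ 0V) where

    v-coefficient-unique : ∀ {a b c d u₁ u₂} → U u₁ → U u₂ →
                           a · u₁ ⊕ c · v ≡ b · u₂ ⊕ d · v → c ≡ d
    v-coefficient-unique {a} {b} {c} {d} {u₁} {u₂} U-u₁ U-u₂ eq with (c +ᶠ - 1# *ᶠ d) ≟ 0#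
    ... | yes c-d≡0 = x-y≡0⇒x≡y c d c-d≡0
    ... | no c-d≢0 =
      ⊥-elim (·-nonZero _ c-d≢0 v≢0 (⟨v⟩∩⟨U⟩≡0 _ _ refl (span₂ b (- 1# *ᶠ a) U-u₂ U-u₁ [c-d]v≡)))
      where
      [c-d]v≡ : (c +ᶠ - 1# *ᶠ d) · v ≡ b · u₂ ⊕ (- 1# *ᶠ a) · u₁
      [c-d]v≡ = begin
        (c +ᶠ - 1# *ᶠ d) · v      ≡⟨ ·-⊖-distribʳ c d v ⟨
        c · v ⊖ d · v             ≡⟨ x⊕y≡z⊕w⇒y⊖w≡z⊖x eq ⟩
        b · u₂ ⊖ a · u₁           ≡⟨ cong (b · u₂ ⊕_) (·-assoc (- 1#) a u₁) ⟩
        b · u₂ ⊕ (- 1# *ᶠ a) · u₁ ∎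

    ⊕v∉⟨U⟩ : ∀ {b u₁ u₂} → U u₁ → U u₂ → ¬ u₁ ⊕ v ≡ b · u₂
    ⊕v∉⟨U⟩ {b} {u₁} {u₂} U-u₁ U-u₂ eq = 1≢0 (v-coefficient-unique U-u₁ U-u₂ (begin
      1# · u₁ ⊕ 1# · v          ≡⟨ cong₂ _⊕_ (·-identityˡ u₁) (·-identityˡ v) ⟩
      u₁ ⊕ v                    ≡⟨ eq ⟩
      b · u₂                    ≡⟨ ⊕-v-vanishes (·-zeroˡ v) ⟨
      b · u₂ ⊕ 0# · v           ∎))

    module _ {u′} (U-u′ : U u′) (W-u′⊕v : W (u′ ⊕ v))
             {M : ℕ} (S-enum : Enumeration (λ x → U x × W x) M) where
      open Enumeration S-enum renaming
        (at to e; at-∈ to e-∈; at-injective to e-injective; indexOf to e-index; at-indexOf to e-index-at)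

      y : Fin M → V
      y k = e k ⊕ u′

      U-y : ∀ k → U (y k)
      U-y k = U-⊕ (proj₁ (e-∈ k)) U-u′

      t : Fin M → V
      t k = y k ⊕ v

      W-t : ∀ k → W (t k)
      W-t k = subst W (sym (⊕-assoc (e k) u′ v)) (W-⊕ (proj₂ (e-∈ k)) W-u′⊕v)

      NewPoint : V → Set
      NewPoint x = Σ (Fin M) (λ k → SamePoint (t k) x)

      t≢0 : ∀ k → ¬ t k ≡ 0V
      t≢0 k t≡0 = ⊕v∉⟨U⟩ (U-y k) (U-y k) (trans t≡0 (sym (·-zeroˡ (y k))))

      t-distinct : ∀ k k′ → SamePoint (t k) (t k′) → k ≡ k′
      t-distinct k k′ (c , _ , t′≡ct) =
        e-injective k k′ (⊕-cancelʳ _ _ u′ (⊕-cancelʳ _ _ v t≡t′))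
        where
        c≡1 : c ≡ 1#
        c≡1 = v-coefficient-unique (U-y k) (U-y k′) (begin
          c · y k ⊕ c · v           ≡⟨ ·-distribˡ c (y k) v ⟨
          c · t k                   ≡⟨ t′≡ct ⟨
          t k′                      ≡⟨ cong₂ _⊕_ (·-identityˡ (y k′)) (·-identityˡ v) ⟨
          1# · y k′ ⊕ 1# · v        ∎)
        t≡t′ : t k ≡ t k′
        t≡t′ = trans (sym (·-identityˡ (t k))) (trans (cong (_· t k) (sym c≡1)) (sym t′≡ct))

      L∌t : ∀ x k → L x → ¬ SamePoint x (t k)
      L∌t x k ((_ , d , d≢0 , U-dx) , _) (c , _ , t≡cx) = ⊕v∉⟨U⟩ (U-y k) U-dx (begin
        y k ⊕ v                         ≡⟨ t≡cx ⟩
        c · x                           ≡⟨ cong (c ·_) (·-unscale d d≢0 refl) ⟩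
        c · d ⁻¹⟨ d≢0 ⟩ · d · x         ≡⟨ ·-assoc c _ _ ⟩
        (c *ᶠ d ⁻¹⟨ d≢0 ⟩) · d · x      ∎)

      spanned⇒L : ∀ x → ¬ x ≡ 0V → Spanned e x → L x
      spanned⇒L x x≢0 (k , _ , c , c≢0 , x≡c·ek) =
        (x≢0 , c ⁻¹⟨ c≢0 ⟩ , ⁻¹-nonZero c c≢0 , subst U (·-unscale c c≢0 x≡c·ek) (proj₁ (e-∈ k))) ,
        subst W (sym x≡c·ek) (W-· c (proj₂ (e-∈ k)))

      L⇒spanned : ∀ x → ¬ x ≡ 0V → L x → Spanned e x
      L⇒spanned x x≢0 ((_ , d , d≢0 , U-dx) , W-x) =
        k , ek≢0 , d ⁻¹⟨ d≢0 ⟩ , ⁻¹-nonZero d d≢0 ,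
        trans (·-unscale d d≢0 refl) (cong (d ⁻¹⟨ d≢0 ⟩ ·_) (sym ek≡dx))
        where
        k : Fin M
        k = e-index (d · x) (U-dx , W-· d W-x)
        ek≡dx : e k ≡ d · x
        ek≡dx = e-index-at _ _
        ek≢0 : ¬ e k ≡ 0V
        ek≢0 ek≡0 = ·-nonZero d d≢0 x≢0 (trans (sym ek≡dx) ek≡0)

      L⊎new⇒L₁ : ∀ x → ¬ x ≡ 0V → L x ⊎ NewPoint x → L₁ x
      L⊎new⇒L₁ x _ (inj₁ ((x≢0 , d , d≢0 , U-dx) , W-x)) = (x≢0 , d , d≢0 , U⊆U₁ U-dx) , W-x
      L⊎new⇒L₁ x x≢0 (inj₂ (k , c , c≢0 , x≡c·tk)) =
        (x≢0 , c ⁻¹⟨ c≢0 ⟩ , ⁻¹-nonZero c c≢0 , y k , 1# , U-y k , K-1 ,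
         trans (sym (·-unscale c c≢0 x≡c·tk)) (cong (y k ⊕_) (sym (·-identityˡ v)))) ,
        subst W (sym x≡c·tk) (W-· c (W-t k))

      L₁⇒L⊎new : ∀ x → ¬ x ≡ 0V → L₁ x → L x ⊎ NewPoint x
      L₁⇒L⊎new x x≢0 ((_ , c , c≢0 , u , a , U-u , K-a , cx≡u+av) , W-x) with a ≟ 0#
      ... | yes a≡0 = inj₁ ((x≢0 , c , c≢0 , subst U (sym cx≡u) U-u) , W-x)
        where
        cx≡u : c · x ≡ u
        cx≡u = trans cx≡u+av (⊕-v-vanishes (trans (cong (_· v) a≡0) (·-zeroˡ v)))
      ... | no a≢0 =
        inj₂ (k , samePoint-sym (a ⁻¹⟨ a≢0 ⟩ *ᶠ c , *-nonZero _ c (⁻¹-nonZero a a≢0) c≢0 , tk≡))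
        where
        a⁻¹u : V
        a⁻¹u = a ⁻¹⟨ a≢0 ⟩ · u
        a⁻¹cx≡ : a ⁻¹⟨ a≢0 ⟩ · c · x ≡ a⁻¹u ⊕ v
        a⁻¹cx≡ = ⊕-·-unscale a a≢0 cx≡u+av
        w : V
        w = a⁻¹u ⊖ u′
        w≡ : w ≡ a ⁻¹⟨ a≢0 ⟩ · c · x ⊖ (u′ ⊕ v)
        w≡ = begin
          a⁻¹u ⊖ u′                      ≡⟨ ⊕-identityʳ w ⟨
          (a⁻¹u ⊖ u′) ⊕ 0V               ≡⟨ cong ((a⁻¹u ⊖ u′) ⊕_) (⊖-self v) ⟨
          (a⁻¹u ⊖ u′) ⊕ (v ⊖ v)          ≡⟨ ⊕-⊖-interchange a⁻¹u v u′ v ⟨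
          (a⁻¹u ⊕ v) ⊖ (u′ ⊕ v)          ≡⟨ cong (_⊖ (u′ ⊕ v)) a⁻¹cx≡ ⟨
          a ⁻¹⟨ a≢0 ⟩ · c · x ⊖ (u′ ⊕ v) ∎
        k : Fin M
        k = e-index w ( U-⊖ (U-· (K-⁻¹ a a≢0 K-a) U-u) U-u′
                      , subst W (sym w≡) (W-⊖ (W-· _ (W-· c W-x)) W-u′⊕v))
        tk≡ : t k ≡ (a ⁻¹⟨ a≢0 ⟩ *ᶠ c) · x
        tk≡ = begin
          (e k ⊕ u′) ⊕ v                 ≡⟨ cong (λ z → (z ⊕ u′) ⊕ v) (e-index-at _ _) ⟩
          (w ⊕ u′) ⊕ v                   ≡⟨ cong (_⊕ v) (⊖-⊕-cancel a⁻¹u u′) ⟩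
          a⁻¹u ⊕ v                       ≡⟨ a⁻¹cx≡ ⟨
          a ⁻¹⟨ a≢0 ⟩ · c · x            ≡⟨ ·-assoc _ c x ⟩
          (a ⁻¹⟨ a≢0 ⟩ *ᶠ c) · x         ∎

      count : Σ ℕ (λ b → PointCount L b × PointCount L₁ (b + M))
      count with pointCount-spanned M e
      ... | b , pc-spanned =
        b , pc , pointCount-cong L⊎new⇒L₁ L₁⇒L⊎new (pointCount-++ pc t t≢0 t-distinct L∌t)
        where
        pc : PointCount L b
        pc = pointCount-cong spanned⇒L L⇒spanned pc-spanned

  count-from-outside-point : ∀ {x₀ M} → W x₀ → InL U₁ x₀ → ¬ InL U x₀ →
                             Enumeration (λ x → U x × W x) M →
                             Σ ℕ (λ b → PointCount L b × PointCount L₁ (b + M))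
  count-from-outside-point W-x₀ x₀∈L₁ x₀∉L S-enum
    with outside-point⇒translate W-x₀ x₀∈L₁ x₀∉L
  ... | v≢0 , _ , U-u′ , W-u′⊕v = count v≢0 U-u′ W-u′⊕v S-enum

proposition3p2 :
    (q n r : ℕ) (F : Field) (K : Field.Carrier F → Set) →
    HasSize {Field.Carrier F} (λ _ → ⊤) (q ^ n) →
    Geom.IsSubfield F r K → HasSize K q →
    (U : Geom.V F r → Set) → Geom.IsSubspaceOver F r K U →
    ¬ (∀ x → Geom.SpanF F r U x) →
    (v : Geom.V F r) →
    (∀ c x → x ≡ Geom._·_ F r c v → Geom.SpanF F r U x → x ≡ Geom.0V F r) →
    (W : Geom.V F r → Set) → Geom.IsFSubspace F r W →
    (j : ℕ) → Geom.DimOver F r K (λ x → U x × W x) j → j > 0 →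
    Σ (Geom.V F r) (λ x → W x × Geom.InL F r (Geom.AddVec F r K U v) x
      × ¬ Geom.InL F r U x) →
    Σ ℕ (λ b → Geom.PointCount F r (λ x → Geom.InL F r U x × W x) b
      × Geom.PointCount F r (λ x → Geom.InL F r (Geom.AddVec F r K U v) x × W x) (b + q ^ j))
proposition3p2 q n r F K |F| K-subfield |K| U U-subspace _ v ⟨v⟩∩⟨U⟩≡0 W W-subspace j dim _
               (x₀ , W-x₀ , x₀∈L₁ , x₀∉L) =
  count-from-outside-point W-x₀ x₀∈L₁ x₀∉L
    (dimOver⇒enumeration (subspace-∩ U-subspace W-subspace) |K| dim)
  where
  open Subspaces F r K K-subfield using (dimOver⇒enumeration; subspace-∩)
  open Extension F r K K-subfield (hasSize⇒enumeration |F|) U U-subspace v ⟨v⟩∩⟨U⟩≡0 W W-subspace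
    using (count-from-outside-point)
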